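{- Let $r,k$ be positive integers with $k<r/2$, let $n,m\geq 1$, and let an $(r,k)$-colouring $\varphi$ of $K_{n,m}$ be given. Suppose there are a vertex $v$ and a set $\mathcal{C}\subseteq[r]$ of $k$ colours such that no edge $e$ incident with $v$ has $\varphi(e)=\mathcal{C}$. Then there is a set $\mathcal{C}'\subseteq[r]$ of $k$ colours such that (a) no edge $e$ incident with $v$ has $\varphi(e)=\mathcal{C}'$, and (b) there is an edge $e$ incident with $v$ with $\varphi(e)\cap\mathcal{C}'=\emptyset$.
   Context: For integers $r\geq k\geq 1$, an $(r,k)$-colouring of a graph $G$ is a function $\varphi:E(G)\to\binom{[r]}{k}$, assigning to each edge a set of exactly $k$ colours from $[r]=\{1,\dots,r\}$. $K_{n,m}$ is the complete bipartite graph with parts of sizes $n$ and $m$. -}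

module Defs where

open import Data.Nat using (ℕ)
open import Data.Fin using (Fin)
open import Data.Fin.Subset using (Subset; ∣_∣)
open import Data.Sum using (_⊎_; inj₁; inj₂)
open import Data.Product using (Σ; _×_)
open import Relation.Binary.PropositionalEquality using (_≡_)

KSet : ℕ → ℕ → Set
KSet r k = Σ (Subset r) (λ C → ∣ C ∣ ≡ k)

-- An (r,k)-colouring of K_{n,m}: parts Fin n and Fin m, edge set Fin n × Fin m,
-- each edge receives a set of exactly k colours from [r].
record Colouring (r k n m : ℕ) : Set where
  field
    col  : Fin n → Fin m → Subset r
    size : ∀ i j → ∣ col i j ∣ ≡ k

Vertex : ℕ → ℕ → Set
Vertex n m = Fin n ⊎ Fin m

IncEdge : {n m : ℕ} → Vertex n m → Set
IncEdge {n} {m} (inj₁ _) = Fin m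
IncEdge {n} {m} (inj₂ _) = Fin n

colourAt : {r k n m : ℕ} → Colouring r k n m → (v : Vertex n m) → IncEdge v → Subset r
colourAt φ (inj₁ i) j = Colouring.col φ i j
colourAt φ (inj₂ j) i = Colouring.col φ i j

-- Fix an edge e₀ at v with colour set A and start from the absent k-set T = C.
-- While A ∩ T contains some x, exchange x for a colour y outside A ∪ T, which
-- exists because |A ∪ T| ≤ 2k < r. If the new set T′ is absent again, recurse:
-- |A ∩ T′| < |A ∩ T|. If T′ is present, both T and T′ lie in U = T ∪ {y}, and
-- since |U| + k = 2k + 1 ≤ r there is a k-set B disjoint from U: if B is absent,
-- the edge coloured T′ avoids it; otherwise the edge coloured B avoids T. When
-- A ∩ T = ∅, the set T is absent and avoided by e₀.
module Submission where

open import Defs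

open import Data.Bool as Bool using ()
open import Data.Empty using (⊥-elim)
open import Data.Fin using (Fin; zero; suc)
open import Data.Fin.Properties using (any?)
open import Data.Fin.Subset
open import Data.Fin.Subset.Properties
open import Data.Nat using (ℕ; zero; suc; _+_; _*_; _≤_; _<_; s≤s; z≤n)
open import Data.Nat.Properties as ℕ using ()
open import Data.Product using (Σ; ∃; _×_; _,_; proj₁; proj₂)
open import Data.Sum as Sum using (_⊎_; inj₁; inj₂)
open import Data.Vec using ([]; _∷_; here; there)
open import Data.Vec.Properties using (≡-dec)
open import Function using (_∘_; Equivalence)
open import Relation.Binary.PropositionalEquality using (_≡_; cong; cong₂; subst; subst₂; sym; trans)
open import Relation.Nullary using (¬_; Dec; yes; no)

∣p∪q∣≤∣p∣+∣q∣ : ∀ {n} (p q : Subset n) → ∣ p ∪ q ∣ ≤ ∣ p ∣ + ∣ q ∣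
∣p∪q∣≤∣p∣+∣q∣ []            []            = z≤n
∣p∪q∣≤∣p∣+∣q∣ (outside ∷ p) (outside ∷ q) = ∣p∪q∣≤∣p∣+∣q∣ p q
∣p∪q∣≤∣p∣+∣q∣ (inside  ∷ p) (outside ∷ q) = s≤s (∣p∪q∣≤∣p∣+∣q∣ p q)
∣p∪q∣≤∣p∣+∣q∣ (outside ∷ p) (inside  ∷ q)
  rewrite ℕ.+-suc ∣ p ∣ ∣ q ∣ = s≤s (∣p∪q∣≤∣p∣+∣q∣ p q)
∣p∪q∣≤∣p∣+∣q∣ (inside  ∷ p) (inside  ∷ q)
  rewrite ℕ.+-suc ∣ p ∣ ∣ q ∣ = s≤s (ℕ.m≤n⇒m≤1+n (∣p∪q∣≤∣p∣+∣q∣ p q))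

∣p∣<n⇒∃x∉p : ∀ {n} (p : Subset n) → ∣ p ∣ < n → ∃ λ x → x ∉ p
∣p∣<n⇒∃x∉p []            ()
∣p∣<n⇒∃x∉p (outside ∷ p) _ = zero , λ ()
∣p∣<n⇒∃x∉p (inside  ∷ p) (s≤s ∣p∣<n) with ∣p∣<n⇒∃x∉p p ∣p∣<n
... | x , x∉p = suc x , x∉p ∘ drop-there

x∈p⇒suc∣p-x∣≡∣p∣ : ∀ {n} {x : Fin n} {p : Subset n} → x ∈ p → suc ∣ p - x ∣ ≡ ∣ p ∣
x∈p⇒suc∣p-x∣≡∣p∣ {p = inside ∷ p} here = cong (suc ∘ ∣_∣) (p─⊥≡p p)
x∈p⇒suc∣p-x∣≡∣p∣ {p = outside ∷ p} (there x∈p) = x∈p⇒suc∣p-x∣≡∣p∣ x∈p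
x∈p⇒suc∣p-x∣≡∣p∣ {p = inside ∷ p} (there x∈p) = cong suc (x∈p⇒suc∣p-x∣≡∣p∣ x∈p)

x∉p⇒∣p∪⁅x⁆∣≡suc∣p∣ : ∀ {n} {x : Fin n} {p : Subset n} → x ∉ p → ∣ p ∪ ⁅ x ⁆ ∣ ≡ suc ∣ p ∣
x∉p⇒∣p∪⁅x⁆∣≡suc∣p∣ {x = zero}  {outside ∷ p} _   = cong (suc ∘ ∣_∣) (∪-identityʳ p)
x∉p⇒∣p∪⁅x⁆∣≡suc∣p∣ {x = zero}  {inside  ∷ p} x∉p = ⊥-elim (x∉p here)
x∉p⇒∣p∪⁅x⁆∣≡suc∣p∣ {x = suc x} {outside ∷ p} x∉p = x∉p⇒∣p∪⁅x⁆∣≡suc∣p∣ (x∉p ∘ there)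
x∉p⇒∣p∪⁅x⁆∣≡suc∣p∣ {x = suc x} {inside  ∷ p} x∉p = cong suc (x∉p⇒∣p∪⁅x⁆∣≡suc∣p∣ (x∉p ∘ there))

x∈p─q⇒x∉q : ∀ {n} {x : Fin n} {p q : Subset n} → x ∈ p ─ q → x ∉ q
x∈p─q⇒x∉q {p = inside ∷ p} {outside ∷ q} here        ()
x∈p─q⇒x∉q {p = _      ∷ p} {_       ∷ q} (there x∈) (there x∈q) = x∈p─q⇒x∉q x∈ x∈q

⊆-ofSize : ∀ {n k} (p : Subset n) → k ≤ ∣ p ∣ → Σ (Subset n) λ q → q ⊆ p × ∣ q ∣ ≡ k
⊆-ofSize {n} {zero} p _ = ⊥ , ⊆-min p , ∣⊥∣≡0 n
⊆-ofSize {k = suc k} (outside ∷ p) k<∣p∣ with ⊆-ofSize p k<∣p∣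
... | q , q⊆p , ∣q∣≡k = outside ∷ q , Equivalence.to out⊆-⇔ q⊆p , ∣q∣≡k
⊆-ofSize {k = suc k} (inside ∷ p) (s≤s k≤∣p∣) with ⊆-ofSize p k≤∣p∣
... | q , q⊆p , ∣q∣≡k = inside ∷ q , Equivalence.to in⊆in-⇔ q⊆p , cong suc ∣q∣≡k

∃-disjoint-ofSize : ∀ {n k} (p : Subset n) → ∣ p ∣ + k ≤ n → Σ (Subset n) λ q → q ⊆ ∁ p × ∣ q ∣ ≡ k
∃-disjoint-ofSize {n} {k} p ∣p∣+k≤n = ⊆-ofSize (∁ p) k≤∣∁p∣
  where
  k≤∣∁p∣ : k ≤ ∣ ∁ p ∣
  k≤∣∁p∣ = subst₂ _≤_ (ℕ.m+n∸m≡n ∣ p ∣ k) (sym (∣∁p∣≡n∸∣p∣ p)) (ℕ.∸-monoˡ-≤ ∣ p ∣ ∣p∣+k≤n)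

∉⇒Empty[p∩q] : ∀ {n} {p q : Subset n} → (∀ {x} → x ∈ p → x ∉ q) → Empty (p ∩ q)
∉⇒Empty[p∩q] {p = p} {q} p∌q (x , x∈p∩q) = let x∈p , x∈q = x∈p∩q⁻ p q x∈p∩q in p∌q x∈p x∈q

exchange : ∀ {n} → Subset n → Fin n → Fin n → Subset n
exchange p x y = (p - x) ∪ ⁅ y ⁆

module _ {n} {p : Subset n} {x y : Fin n} where

  ∣exchange∣≡ : x ∈ p → y ∉ p → ∣ exchange p x y ∣ ≡ ∣ p ∣
  ∣exchange∣≡ x∈p y∉p = trans (x∉p⇒∣p∪⁅x⁆∣≡suc∣p∣ (y∉p ∘ p─q⊆p p ⁅ x ⁆)) (x∈p⇒suc∣p-x∣≡∣p∣ x∈p)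

  exchange⊆p∪⁅y⁆ : exchange p x y ⊆ p ∪ ⁅ y ⁆
  exchange⊆p∪⁅y⁆ z∈ = x∈p∪q⁺ (Sum.map₁ (p─q⊆p p ⁅ x ⁆) (x∈p∪q⁻ (p - x) ⁅ y ⁆ z∈))

  ∣q∩exchange∣<∣q∩p∣ : ∀ {q} → x ∈ q → x ∈ p → y ∉ q → ∣ q ∩ exchange p x y ∣ < ∣ q ∩ p ∣
  ∣q∩exchange∣<∣q∩p∣ {q} x∈q x∈p y∉q = p⊂q⇒∣p∣<∣q∣ (q∩exchange⊆q∩p , x , x∈p∩q⁺ (x∈q , x∈p) , x∉q∩exchange)
    where
    q∩exchange⊆q∩p : q ∩ exchange p x y ⊆ q ∩ p
    q∩exchange⊆q∩p {z} z∈ with x∈p∩q⁻ q _ z∈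
    ... | z∈q , z∈exchange with x∈p∪q⁻ (p - x) ⁅ y ⁆ z∈exchange
    ...   | inj₁ z∈p-x = x∈p∩q⁺ (z∈q , p─q⊆p p ⁅ x ⁆ z∈p-x)
    ...   | inj₂ z∈⁅y⁆ = ⊥-elim (y∉q (subst (_∈ q) (x∈⁅y⁆⇒x≡y y z∈⁅y⁆) z∈q))
    x∉q∩exchange : x ∉ q ∩ exchange p x y
    x∉q∩exchange x∈ with x∈p∪q⁻ (p - x) ⁅ y ⁆ (proj₂ (x∈p∩q⁻ q _ x∈))
    ... | inj₁ x∈p-x = x∈p─q⇒x∉q x∈p-x (x∈⁅x⁆ x)
    ... | inj₂ x∈⁅y⁆ = y∉q (subst (_∈ q) (x∈⁅y⁆⇒x≡y y x∈⁅y⁆) x∈q)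

∣colourAt∣≡k : ∀ {r k n m} (φ : Colouring r k n m) (v : Vertex n m) (e : IncEdge v) → ∣ colourAt φ v e ∣ ≡ k
∣colourAt∣≡k φ (inj₁ i) j = Colouring.size φ i j
∣colourAt∣≡k φ (inj₂ j) i = Colouring.size φ i j

incEdge : ∀ {n m} (v : Vertex n m) → 1 ≤ n → 1 ≤ m → IncEdge v
incEdge {m = suc _} (inj₁ _) _ _ = zero
incEdge {n = suc _} (inj₂ _) _ _ = zero

anyIncEdge? : ∀ {n m} (v : Vertex n m) {P : IncEdge v → Set} → (∀ e → Dec (P e)) → Dec (∃ P)
anyIncEdge? (inj₁ _) = any?
anyIncEdge? (inj₂ _) = any?

module _ {r k n m} (φ : Colouring r k n m) (v : Vertex n m) where

  Present Absent Avoidable : Subset r → Set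
  Present T   = Σ (IncEdge v) λ e → colourAt φ v e ≡ T
  Absent T    = (e : IncEdge v) → ¬ (colourAt φ v e ≡ T)
  Avoidable T = Σ (IncEdge v) λ e → Empty (colourAt φ v e ∩ T)

  Solution : Set
  Solution = Σ (KSet r k) λ C′ → Absent (proj₁ C′) × Avoidable (proj₁ C′)

  present⊎absent : ∀ T → Present T ⊎ Absent T
  present⊎absent T with anyIncEdge? v (λ e → ≡-dec Bool._≟_ (colourAt φ v e) T)
  ... | yes present = inj₁ present
  ... | no ¬present = inj₂ λ e e≡T → ¬present (e , e≡T)

  absent-present⇒Solution : ∀ {T T′ U} → ∣ T ∣ ≡ k → Absent T → Present T′
    → T ⊆ U → T′ ⊆ U → ∣ U ∣ + k ≤ r → Solution
  absent-present⇒Solution {T} {T′} {U} ∣T∣≡k T-absent (e′ , e′≡T′) T⊆U T′⊆U ∣U∣+k≤r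
    with ∃-disjoint-ofSize U ∣U∣+k≤r
  ... | B , B⊆∁U , ∣B∣≡k with present⊎absent B
  ... | inj₁ (e″ , e″≡B) = (T , ∣T∣≡k) , T-absent , e″ , ∉⇒Empty[p∩q] λ z∈e″ z∈T →
          x∈∁p⇒x∉p (B⊆∁U (subst (_ ∈_) e″≡B z∈e″)) (T⊆U z∈T)
  ... | inj₂ B-absent = (B , ∣B∣≡k) , B-absent , e′ , ∉⇒Empty[p∩q] λ z∈e′ z∈B →
          x∈∁p⇒x∉p (B⊆∁U z∈B) (T′⊆U (subst (_ ∈_) e′≡T′ z∈e′))

  module _ (e₀ : IncEdge v) (k+k<r : k + k < r) where

    A : Subset r
    A = colourAt φ v e₀

    exchange-step : ∀ {T x y} → ∣ T ∣ ≡ k → Absent T → x ∈ A → x ∈ T → y ∉ A → y ∉ T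
      → Solution ⊎ Σ (Subset r) λ T′ → ∣ T′ ∣ ≡ k × Absent T′ × ∣ A ∩ T′ ∣ < ∣ A ∩ T ∣
    exchange-step {T} {x} {y} ∣T∣≡k T-absent x∈A x∈T y∉A y∉T with present⊎absent (exchange T x y)
    ... | inj₁ present = inj₁ (absent-present⇒Solution ∣T∣≡k T-absent present
                                 (p⊆p∪q ⁅ y ⁆) exchange⊆p∪⁅y⁆ ∣T∪⁅y⁆∣+k≤r)
      where
      ∣T∪⁅y⁆∣+k≤r : ∣ T ∪ ⁅ y ⁆ ∣ + k ≤ r
      ∣T∪⁅y⁆∣+k≤r = subst (λ s → s + k ≤ r) (sym (trans (x∉p⇒∣p∪⁅x⁆∣≡suc∣p∣ y∉T) (cong suc ∣T∣≡k))) k+k<r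
    ... | inj₂ absent = inj₂ (exchange T x y , trans (∣exchange∣≡ x∈T y∉T) ∣T∣≡k , absent ,
                              ∣q∩exchange∣<∣q∩p∣ x∈A x∈T y∉A)

    ∣A∪T∣<r : ∀ {T} → ∣ T ∣ ≡ k → ∣ A ∪ T ∣ < r
    ∣A∪T∣<r {T} ∣T∣≡k = ℕ.≤-<-trans (∣p∪q∣≤∣p∣+∣q∣ A T)
      (subst (_< r) (sym (cong₂ _+_ (∣colourAt∣≡k φ v e₀) ∣T∣≡k)) k+k<r)

    descend : ∀ d {T} → ∣ A ∩ T ∣ < d → ∣ T ∣ ≡ k → Absent T → Solution
    descend (suc d) {T} ∣A∩T∣≤d ∣T∣≡k T-absent with nonempty? (A ∩ T)
    ... | no A∩T-empty = (T , ∣T∣≡k) , T-absent , e₀ , A∩T-empty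
    ... | yes (x , x∈A∩T) with x∈p∩q⁻ A T x∈A∩T | ∣p∣<n⇒∃x∉p (A ∪ T) (∣A∪T∣<r ∣T∣≡k)
    ... | x∈A , x∈T | y , y∉A∪T
      with exchange-step ∣T∣≡k T-absent x∈A x∈T (y∉A∪T ∘ x∈p∪q⁺ ∘ inj₁) (y∉A∪T ∘ x∈p∪q⁺ ∘ inj₂)
    ... | inj₁ solution = solution
    ... | inj₂ (T′ , ∣T′∣≡k , T′-absent , ∣A∩T′∣<∣A∩T∣) =
          descend d (ℕ.<-≤-trans ∣A∩T′∣<∣A∩T∣ (ℕ.≤-pred ∣A∩T∣≤d)) ∣T′∣≡k T′-absent

lemma3p3 : (r k n m : ℕ) → 1 ≤ k → 2 * k < r → 1 ≤ n → 1 ≤ m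
    → (φ : Colouring r k n m) → (v : Vertex n m) → (C : KSet r k)
    → ((e : IncEdge v) → ¬ (colourAt φ v e ≡ proj₁ C))
    → Σ (KSet r k) (λ C′ →
        ((e : IncEdge v) → ¬ (colourAt φ v e ≡ proj₁ C′))
        × Σ (IncEdge v) (λ e → Empty (colourAt φ v e ∩ proj₁ C′)))
lemma3p3 r k n m _ 2k<r 1≤n 1≤m φ v (C , ∣C∣≡k) C-absent =
  descend φ v (incEdge v 1≤n 1≤m) k+k<r (suc _) ℕ.≤-refl ∣C∣≡k C-absent
  where
  k+k<r : k + k < r
  k+k<r = subst (_< r) (cong (k +_) (ℕ.+-identityʳ k)) 2k<r
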